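{- Let $\mathsf G=\langle G,\cdot,1\rangle$ be a group, let $D$ be a quasi difference set in $\mathsf G$ with $1\in D$, and let $a_1,a_2\in G$. The points $(a_1)$ and $(a_2)$ can be joined by a polygonal path in $\mathbf D(\mathsf G,D)$ if and only if there is a finite sequence $q_1,\ldots,q_s$ of elements of $D^{ -1}D=\{x^{ -1}y\colon x,y\in D\}$ such that $a_1=q_1\cdots q_s\cdot a_2$. Consequently, the connected component of the point $(1)$ is isomorphic to $\mathbf D(\langle D\rangle_{\mathsf G},D)$, where $\langle D\rangle_{\mathsf G}$ is the subgroup of $\mathsf G$ generated by $D$, and any two connected components of $\mathbf D(\mathsf G,D)$ are isomorphic.
   Context: For a group $\mathsf G=\langle G,\cdot,1\rangle$ and a subset $D\subseteq G$, $\mathbf D(\mathsf G,D)$ is the incidence structure whose points are the elements $a\in G$ (written $(a)$) and whose lines are the left translates $b\cdot D$, $b\in G$ (written $[b]$); $(a)$ is incident with $[b]$ iff $a\in b\cdot D$. A subset $D\subseteq G$ is a quasi difference set in $\mathsf G$ if for every $c\neq 1$ there is at most one pair $(a,b)\in D\times D$ with $ab^{ -1}=c$. Two points are collinear if some line is incident with both; a polygonal path is a finite sequence of points in which consecutive points are collinear; connected components are the classes of points joinable by polygonal paths (with the lines among them). -}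

module Defs where

open import Level using (Level; _⊔_) renaming (suc to lsuc)
open import Algebra.Bundles using (Group)
open import Algebra.Structures using (IsGroup)
open import Relation.Unary using (Pred)
open import Relation.Binary using (Setoid; IsEquivalence)
open import Relation.Nullary using (¬_)
open import Data.Product using (Σ; ∃; ∃₂; _×_; _,_; proj₁; proj₂)
open import Data.List using (List; []; _∷_; foldr)
open import Function.Bundles using (Bijection; _⇔_)

record IncidenceStructure (p pℓ l lℓ i : Level) : Set (lsuc (p ⊔ pℓ ⊔ l ⊔ lℓ ⊔ i)) where
  field
    Points : Setoid p pℓ
    Lines  : Setoid l lℓ
  open Setoid Points public using () renaming (Carrier to Point; _≈_ to _≈ₚ_)
  open Setoid Lines  public using () renaming (Carrier to Line;  _≈_ to _≈ₗ_)
  field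
    _I_   : Point → Line → Set i
    I-resp : ∀ {x x' L L'} → x ≈ₚ x' → L ≈ₗ L' → x I L → x' I L'

module _ {p pℓ l lℓ i} (S : IncidenceStructure p pℓ l lℓ i) where
  open IncidenceStructure S

  Collinear : Point → Point → Set (l ⊔ i)
  Collinear x y = ∃ λ L → x I L × y I L

  data Path (x : Point) : Point → Set (p ⊔ pℓ ⊔ l ⊔ i) where
    here : ∀ {y} → x ≈ₚ y → Path x y
    step : ∀ {y z} → Path x y → Collinear y z → Path x z

  Joinable : Point → Point → Set (p ⊔ pℓ ⊔ l ⊔ i)
  Joinable = Path

  Component : Point → IncidenceStructure (p ⊔ pℓ ⊔ l ⊔ i) pℓ
                                         (p ⊔ pℓ ⊔ l ⊔ i) lℓ i
  Component q = record
    { Points = record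
        { Carrier = Σ Point (Path q)
        ; _≈_ = λ x y → proj₁ x ≈ₚ proj₁ y
        ; isEquivalence = record
            { refl = Setoid.refl Points
            ; sym = Setoid.sym Points
            ; trans = Setoid.trans Points } }
    ; Lines = record
        { Carrier = Σ Line (λ L → ∃ λ x → Path q x × x I L)
        ; _≈_ = λ L M → proj₁ L ≈ₗ proj₁ M
        ; isEquivalence = record
            { refl = Setoid.refl Lines
            ; sym = Setoid.sym Lines
            ; trans = Setoid.trans Lines } }
    ; _I_ = λ x L → proj₁ x I proj₁ L
    ; I-resp = I-resp
    }

record _≅_ {p pℓ l lℓ i p' pℓ' l' lℓ' i'}
           (S : IncidenceStructure p pℓ l lℓ i)
           (T : IncidenceStructure p' pℓ' l' lℓ' i')
           : Set (p ⊔ pℓ ⊔ l ⊔ lℓ ⊔ i ⊔ p' ⊔ pℓ' ⊔ l' ⊔ lℓ' ⊔ i') where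
  private
    module S = IncidenceStructure S
    module T = IncidenceStructure T
  field
    pointBij : Bijection S.Points T.Points
    lineBij  : Bijection S.Lines T.Lines
    incidence : ∀ x L → (x S.I L) ⇔ (Bijection.to pointBij x T.I Bijection.to lineBij L)

module _ {c ℓ} (G : Group c ℓ) where
  open Group G

  -- the incidence structure 𝐃(G, D): points (a), lines [b] = b·D,
  -- (a) incident with [b] iff a ∈ b·D
  𝐃 : ∀ {d} → Pred Carrier d → IncidenceStructure c ℓ c ℓ (c ⊔ ℓ ⊔ d)
  𝐃 D = record
    { Points = setoid
    ; Lines = setoid
    ; _I_ = λ a b → ∃ λ x → D x × a ≈ b ∙ x
    ; I-resp = λ a≈a' b≈b' (x , Dx , a≈bx) →
        x , Dx , trans (sym a≈a') (trans a≈bx (∙-cong b≈b' refl))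
    }

  QuasiDifferenceSet : ∀ {d} → Pred Carrier d → Set (c ⊔ ℓ ⊔ d)
  QuasiDifferenceSet D =
    ∀ z → ¬ (z ≈ ε) → ∀ a b a' b' → D a → D b → D a' → D b' →
      a ∙ b ⁻¹ ≈ z → a' ∙ b' ⁻¹ ≈ z → a ≈ a' × b ≈ b'

  InvProd : ∀ {d} → Pred Carrier d → Pred Carrier (c ⊔ ℓ ⊔ d)
  InvProd D z = ∃₂ λ x y → D x × D y × z ≈ x ⁻¹ ∙ y

  prod : List Carrier → Carrier
  prod = foldr _∙_ ε

  data ⟨_⟩ {d} (D : Pred Carrier d) : Pred Carrier (c ⊔ ℓ ⊔ d) where
    gen  : ∀ {x} → D x → ⟨ D ⟩ x
    one  : ⟨ D ⟩ ε
    mul  : ∀ {x y} → ⟨ D ⟩ x → ⟨ D ⟩ y → ⟨ D ⟩ (x ∙ y)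
    inv  : ∀ {x} → ⟨ D ⟩ x → ⟨ D ⟩ (x ⁻¹)
    resp : ∀ {x y} → x ≈ y → ⟨ D ⟩ x → ⟨ D ⟩ y

  GenSubgroup : ∀ {d} → Pred Carrier d → Group (c ⊔ ℓ ⊔ d) ℓ
  GenSubgroup D = record
    { Carrier = Σ Carrier ⟨ D ⟩
    ; _≈_ = λ x y → proj₁ x ≈ proj₁ y
    ; _∙_ = λ x y → (proj₁ x ∙ proj₁ y) , mul (proj₂ x) (proj₂ y)
    ; ε = ε , one
    ; _⁻¹ = λ x → (proj₁ x ⁻¹) , inv (proj₂ x)
    ; isGroup = record
        { isMonoid = record
            { isSemigroup = record
                { isMagma = record
                    { isEquivalence = record { refl = refl ; sym = sym ; trans = trans }
                    ; ∙-cong = ∙-cong }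
                ; assoc = λ x y z → assoc (proj₁ x) (proj₁ y) (proj₁ z) }
            ; identity = (λ x → proj₁ identity (proj₁ x)) , (λ x → proj₂ identity (proj₁ x)) }
        ; inverse = (λ x → proj₁ inverse (proj₁ x)) , (λ x → proj₂ inverse (proj₁ x))
        ; ⁻¹-cong = ⁻¹-cong }
    }

  restrictToGen : ∀ {d} (D : Pred Carrier d) → Pred (Group.Carrier (GenSubgroup D)) d
  restrictToGen D x = D (proj₁ x)

module Submission where

-- Everything rests on one observation: two points (y), (z) of 𝐃(G, D) are
-- collinear iff y ≈ z · q for some q ∈ D⁻¹D.  (If y = L·u and z = L·v with
-- u, v ∈ D then y = z·(v⁻¹u); conversely y = z·(v⁻¹u) puts both points on
-- the line [z·v⁻¹].)  Iterating this along a polygonal path gives part (1).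
-- For part (2), part (1) shows that every point joinable with (1) is the
-- inverse of a product of elements of D⁻¹D, hence lies in ⟨D⟩; conversely,
-- since 1 ∈ D every generator is collinear with (1), and left translations
-- preserve joinability, so the points joinable with (1) form a subgroup
-- containing D.  The component of (1) and 𝐃(⟨D⟩, D) then have the same
-- points, lines and incidence.  For part (3), left translation by y·x⁻¹ is
-- an automorphism of 𝐃(G, D) sending (x) to (y), hence it maps the
-- component of (x) onto that of (y).

open import Defs
open import Algebra.Bundles using (Group)
open import Relation.Unary using (Pred)
open import Relation.Binary using (Setoid)
open import Data.Product using (∃; _×_; _,_)
open import Data.List using (List; []; _∷_)
open import Data.List.Relation.Unary.All using (All; []; _∷_)
open import Function.Bundles using (_⇔_; mk⇔)
import Algebra.Properties.Group as GroupProperties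
import Relation.Binary.Reasoning.Setoid as SetoidReasoning

module PathAlgebra {p pℓ l lℓ i} (S : IncidenceStructure p pℓ l lℓ i) where
  open IncidenceStructure S
  open Setoid Points using (refl; sym; trans)

  path-startResp : ∀ {x x' y} → x ≈ₚ x' → Path S x y → Path S x' y
  path-startResp x≈x' (here x≈y)  = here (trans (sym x≈x') x≈y)
  path-startResp x≈x' (step p yz) = step (path-startResp x≈x' p) yz

  path-endResp : ∀ {x y y'} → y ≈ₚ y' → Path S x y → Path S x y'
  path-endResp y≈y' (here x≈y) = here (trans x≈y y≈y')
  path-endResp z≈z' (step p (L , yIL , zIL)) =
    step p (L , yIL , I-resp z≈z' (Setoid.refl Lines) zIL)

  path-++ : ∀ {x y z} → Path S x y → Path S y z → Path S x z
  path-++ p (here y≈z)  = path-endResp y≈z p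
  path-++ p (step q c) = step (path-++ p q) c

  collinear-sym : ∀ {y z} → Collinear S y z → Collinear S z y
  collinear-sym (L , yIL , zIL) = L , zIL , yIL

  path-sym : ∀ {x y} → Path S x y → Path S y x
  path-sym (here x≈y)  = here (sym x≈y)
  path-sym (step p yz) = path-++ (step (here refl) (collinear-sym yz)) (path-sym p)

module _ {p pℓ l lℓ i p' pℓ' l' lℓ' i'}
         (S : IncidenceStructure p pℓ l lℓ i)
         (T : IncidenceStructure p' pℓ' l' lℓ' i') where
  private
    module S = IncidenceStructure S
    module T = IncidenceStructure T

  path-map : (f : S.Point → T.Point) (g : S.Line → T.Line) →
             (∀ {x y} → x S.≈ₚ y → f x T.≈ₚ f y) →
             (∀ {x L} → x S.I L → f x T.I g L) →
             ∀ {x y} → Path S x y → Path T (f x) (f y)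
  path-map f g f-cong f-inc (here x≈y) = here (f-cong x≈y)
  path-map f g f-cong f-inc (step p (L , yIL , zIL)) =
    step (path-map f g f-cong f-inc p) (g L , f-inc yIL , f-inc zIL)

module Geometry {c ℓ d} (G : Group c ℓ) (D : Pred (Group.Carrier G) d) where
  open Group G
  open GroupProperties G using (x≈z//y; //-rightDividesˡ; \\-leftDividesˡ; \\-leftDividesʳ;
                                ∙-cancelˡ; inverseˡ-unique)
  open SetoidReasoning setoid
  open IncidenceStructure (𝐃 G D) using (_I_)
  open PathAlgebra (𝐃 G D)

  translate-I : ∀ t {a L} → a I L → (t ∙ a) I (t ∙ L)
  translate-I t {a} {L} (u , Du , a≈Lu) = u , Du , (begin
    t ∙ a        ≈⟨ ∙-congˡ a≈Lu ⟩
    t ∙ (L ∙ u)  ≈⟨ assoc t L u ⟨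
    t ∙ L ∙ u    ∎)

  untranslate-I : ∀ t {a L} → (t ∙ a) I (t ∙ L) → a I L
  untranslate-I t {a} {L} (u , Du , ta≈tLu) =
    u , Du , ∙-cancelˡ t a (L ∙ u) (trans ta≈tLu (assoc t L u))

  translate-path : ∀ t {x y} → Path (𝐃 G D) x y → Path (𝐃 G D) (t ∙ x) (t ∙ y)
  translate-path t = path-map (𝐃 G D) (𝐃 G D) (t ∙_) (t ∙_) ∙-congˡ (translate-I t)

  collinear⇒step : ∀ {y z} → Collinear (𝐃 G D) y z →
                   ∃ λ q → InvProd G D q × y ≈ z ∙ q
  collinear⇒step {y} {z} (L , (u , Du , y≈Lu) , (v , Dv , z≈Lv)) =
    v ⁻¹ ∙ u , (v , u , Dv , Du , refl) , (begin
      y               ≈⟨ y≈Lu ⟩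
      L ∙ u           ≈⟨ ∙-congʳ (x≈z//y L v z (sym z≈Lv)) ⟩
      z ∙ v ⁻¹ ∙ u    ≈⟨ assoc z (v ⁻¹) u ⟩
      z ∙ (v ⁻¹ ∙ u)  ∎)

  step⇒collinear : ∀ {y z q} → InvProd G D q → y ≈ z ∙ q → Collinear (𝐃 G D) y z
  step⇒collinear {y} {z} {q} (v , u , Dv , Du , q≈v⁻¹u) y≈zq =
    z ∙ v ⁻¹ , (u , Du , (begin
      y               ≈⟨ y≈zq ⟩
      z ∙ q           ≈⟨ ∙-congˡ q≈v⁻¹u ⟩
      z ∙ (v ⁻¹ ∙ u)  ≈⟨ assoc z (v ⁻¹) u ⟨
      z ∙ v ⁻¹ ∙ u    ∎))
             , (v , Dv , sym (//-rightDividesˡ v z))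

  path⇒word : ∀ {x y} → Path (𝐃 G D) x y →
              ∃ λ qs → All (InvProd G D) qs × x ≈ y ∙ prod G qs
  path⇒word (here x≈y) = [] , [] , trans x≈y (sym (identityʳ _))
  path⇒word {x} (step {y} {z} p yz) with path⇒word p | collinear⇒step yz
  ... | qs , qs∈ , x≈y·qs | q , q∈ , y≈zq = q ∷ qs , q∈ ∷ qs∈ , (begin
    x                    ≈⟨ x≈y·qs ⟩
    y ∙ prod G qs        ≈⟨ ∙-congʳ y≈zq ⟩
    z ∙ q ∙ prod G qs    ≈⟨ assoc z q (prod G qs) ⟩
    z ∙ prod G (q ∷ qs)  ∎)

  word⇒path : ∀ {x y} qs → All (InvProd G D) qs → x ≈ y ∙ prod G qs → Path (𝐃 G D) x y
  word⇒path {y = y} [] [] x≈y·1 = here (trans x≈y·1 (identityʳ y))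
  word⇒path {x} {y} (q ∷ qs) (q∈ ∷ qs∈) x≈y·qqs =
    step (word⇒path qs qs∈ (trans x≈y·qqs (sym (assoc y q (prod G qs)))))
         (step⇒collinear q∈ refl)

  invProd⊆gen : ∀ {q} → InvProd G D q → ⟨ G ⟩ D q
  invProd⊆gen (v , u , Dv , Du , q≈v⁻¹u) = resp (sym q≈v⁻¹u) (mul (inv (gen Dv)) (gen Du))

  prod∈gen : ∀ qs → All (InvProd G D) qs → ⟨ G ⟩ D (prod G qs)
  prod∈gen []       []         = one
  prod∈gen (q ∷ qs) (q∈ ∷ qs∈) = mul (invProd⊆gen q∈) (prod∈gen qs qs∈)

  component⊆gen : ∀ {a} → Path (𝐃 G D) ε a → ⟨ G ⟩ D a
  component⊆gen p with path⇒word p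
  ... | qs , qs∈ , 1≈a·qs =
    resp (sym (inverseˡ-unique _ (prod G qs) (sym 1≈a·qs))) (inv (prod∈gen qs qs∈))

  gen⊆component : D ε → ∀ {a} → ⟨ G ⟩ D a → Path (𝐃 G D) ε a
  gen⊆component D1 (gen {x} Dx) =
    step (here refl) (ε , (ε , D1 , sym (identityʳ ε)) , (x , Dx , sym (identityˡ x)))
  gen⊆component D1 one = here refl
  gen⊆component D1 (mul {x} gx gy) =
    path-++ (gen⊆component D1 gx)
            (path-startResp (identityʳ x) (translate-path x (gen⊆component D1 gy)))
  gen⊆component D1 (inv {x} gx) =
    path-sym (path-endResp (inverseˡ x)
               (path-startResp (identityʳ (x ⁻¹)) (translate-path (x ⁻¹) (gen⊆component D1 gx))))
  gen⊆component D1 (resp a≈b ga) = path-endResp a≈b (gen⊆component D1 ga)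

  line∈gen : ∀ {z L} → ⟨ G ⟩ D z → z I L → ⟨ G ⟩ D L
  line∈gen {z} {L} gz (u , Du , z≈Lu) =
    resp (sym (x≈z//y L u z (sym z≈Lu))) (mul gz (inv (gen Du)))

  component-of-one : D ε → Component (𝐃 G D) ε ≅ 𝐃 (GenSubgroup G D) (restrictToGen G D)
  component-of-one D1 = record
    { pointBij = record
      { to        = λ (a , p) → a , component⊆gen p
      ; cong      = λ a≈b → a≈b
      ; bijective = (λ a≈b → a≈b) , λ (a , ga) → (a , gen⊆component D1 ga) , λ b≈a → b≈a }
    ; lineBij = record
      { to        = λ (L , z , p , zIL) → L , line∈gen (component⊆gen p) zIL
      ; cong      = λ L≈M → L≈M
      ; bijective = (λ L≈M → L≈M) , λ (b , gb) →
          (b , b , gen⊆component D1 gb , ε , D1 , sym (identityʳ b)) , λ M≈b → M≈b }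
    ; incidence = λ _ _ → mk⇔ (λ (u , Du , a≈Lu) → (u , gen Du) , Du , a≈Lu)
                              (λ ((u , _) , Du , a≈Lu) → u , Du , a≈Lu)
    }

  components-isomorphic : ∀ x y → Component (𝐃 G D) x ≅ Component (𝐃 G D) y
  components-isomorphic x y = record
    { pointBij = record
      { to        = λ (a , p) → t ∙ a , forward p
      ; cong      = ∙-congˡ
      ; bijective = ∙-cancelˡ t _ _ , λ (b , q) →
          (t ⁻¹ ∙ b , backward q) , λ a≈t⁻¹b → trans (∙-congˡ a≈t⁻¹b) (\\-leftDividesˡ t b) }
    ; lineBij = record
      { to        = λ (L , z , p , zIL) → t ∙ L , t ∙ z , forward p , translate-I t zIL
      ; cong      = ∙-congˡ
      ; bijective = ∙-cancelˡ t _ _ , λ (M , z , q , zIM) →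
          (t ⁻¹ ∙ M , t ⁻¹ ∙ z , backward q , translate-I (t ⁻¹) zIM)
          , λ L≈t⁻¹M → trans (∙-congˡ L≈t⁻¹M) (\\-leftDividesˡ t M) }
    ; incidence = λ _ _ → mk⇔ (translate-I t) (untranslate-I t)
    }
    where
    t : Carrier
    t = y ∙ x ⁻¹

    t∙x≈y : t ∙ x ≈ y
    t∙x≈y = //-rightDividesˡ x y

    t⁻¹∙y≈x : t ⁻¹ ∙ y ≈ x
    t⁻¹∙y≈x = trans (∙-congˡ (sym t∙x≈y)) (\\-leftDividesʳ t x)

    forward : ∀ {a} → Path (𝐃 G D) x a → Path (𝐃 G D) y (t ∙ a)
    forward p = path-startResp t∙x≈y (translate-path t p)

    backward : ∀ {b} → Path (𝐃 G D) y b → Path (𝐃 G D) x (t ⁻¹ ∙ b)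
    backward q = path-startResp t⁻¹∙y≈x (translate-path (t ⁻¹) q)

proposition2p4 : ∀ {c ℓ d} (G : Group c ℓ) (D : Pred (Group.Carrier G) d) →
    QuasiDifferenceSet G D → D (Group.ε G) →
    (∀ a₁ a₂ → Joinable (𝐃 G D) a₁ a₂ ⇔
        (∃ λ (qs : List (Group.Carrier G)) → All (InvProd G D) qs ×
            Group._≈_ G a₁ (Group._∙_ G a₂ (prod G qs))))
    × (Component (𝐃 G D) (Group.ε G) ≅ 𝐃 (GenSubgroup G D) (restrictToGen G D))
    × (∀ x y → Component (𝐃 G D) x ≅ Component (𝐃 G D) y)
proposition2p4 G D _ D1 =
    (λ _ _ → mk⇔ path⇒word (λ (qs , qs∈ , a₁≈a₂·qs) → word⇒path qs qs∈ a₁≈a₂·qs))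
  , component-of-one D1
  , components-isomorphic
  where open Geometry G D
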